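{- Let $n\geqslant 3$ and let $\vec{h}=(h_1,\ldots,h_n)\in\mathbb{N}^n$ with $1\leqslant h_1\leqslant\cdots\leqslant h_n$. Then for any (finite, nonempty) set of primes $\mathcal{Q}$, $$\frac{1}{\#\mathcal{Q}}\sum_{q\in\mathcal{Q}}\#\mathcal{U}_{n,q}(\vec{h})\ll h_2\log^2 h_2+\frac{h_1h_2h_3\log h_3}{\#\mathcal{Q}\,\log\log h_3},$$ where the implied constant depends only on $n$.
   Context: For a prime $q$, $\mathbb{F}_q$ is identified with $\{0,1,\ldots,q-1\}$ and $\|\zeta\|$ is the distance from a real $\zeta$ to the nearest integer. $\mathcal{U}_{n,q}(\vec{h})$ denotes the set of $u\in\mathbb{F}_q$ for which the Bohr set $\{s\in\mathbb{F}_q:\ \|u^{j} s/q\|\leqslant h_j/q,\ j=1,\ldots,n\}$ contains some $s\neq0$; equivalently, the set of $u\in\mathbb{F}_q$ for which there exist $s\in\{1,\ldots,q-1\}$ and integers $x_j$, $|x_j|\leqslant h_j$, with $s u^{j}\equiv x_j\pmod q$ for $j=1,\ldots,n$. -}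

module Defs where

open import Data.Nat using (ℕ; zero; suc; _+_; _*_; _∸_; _^_; _⊔_; _⊓_; _≤ᵇ_)
open import Data.Nat.DivMod using (_%_)
open import Data.Nat.Logarithm using (⌊log₂_⌋)
open import Data.Fin using (Fin; toℕ)
open import Data.Bool using (Bool; true; false)
open import Data.List using (List; length; filterᵇ; upTo; map)
open import Data.Bool.ListAction using (all; any)
open import Data.List using (allFin)

-- ‖ m / q ‖ * q  for q = suc p : distance of m to the nearest multiple of q
-- (the quantity ‖ m/q ‖ scaled by q; with r = m mod q it is min(r, q - r)).
distq : (p : ℕ) → ℕ → ℕ
distq p m = let r = m % suc p in r ⊓ (suc p ∸ r)

-- s lies in the Bohr set {s : ‖u^j s / q‖ ≤ h_j / q, j = 1..n}, q = suc p.
-- The vector h is indexed by Fin n, with  h j  standing for h_{j+1}.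
inBohrᵇ : (p : ℕ) (n : ℕ) (h : Fin n → ℕ) (u s : ℕ) → Bool
inBohrᵇ p n h u s =
  all (λ j → distq p (s * u ^ suc (toℕ j)) ≤ᵇ h j) (allFin n)

-- u ∈ U_{n,q}(h): the Bohr set contains some s ∈ {1,…,q-1}.
inUᵇ : (p : ℕ) (n : ℕ) (h : Fin n → ℕ) (u : ℕ) → Bool
inUᵇ p n h u = any (λ s → inBohrᵇ p n h u (suc s)) (upTo p)

-- # U_{n,q}(h), u ranging over F_q = {0,…,q-1}.  (q = 0 gives 0; only
-- prime q is ever used.)
#U : (n : ℕ) (q : ℕ) (h : Fin n → ℕ) → ℕ
#U n zero    h = 0
#U n (suc p) h = length (filterᵇ (inUᵇ p n h) (upTo (suc p)))

-- Truncated logarithms: L x ≍ max(1, log x), LL x ≍ max(1, log log x)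
-- (up to absolute multiplicative constants).
L : ℕ → ℕ
L x = 1 ⊔ ⌊log₂ x ⌋

LL : ℕ → ℕ
LL x = 1 ⊔ ⌊log₂ (L x) ⌋

module Submission where

-- Let u ≠ 0 lie in 𝒰_{n,q}(h) with witness s, and let x₁, x₂, x₃ be the representatives of
-- s u, s u², s u³ of least absolute value, so that |xⱼ| ≤ hⱼ.  Then q ∤ x₁, u x₁ ≡ x₂ and
-- x₁ x₃ ≡ x₂² (mod q), so u ≡ x₂ / x₁ is determined by the triple.  If N = x₁ x₃ − x₂² ≠ 0,
-- then q is one of the ≪ log h₃ / log log h₃ prime divisors of N (as |N| ≤ 2 h₃²); summed
-- over q ∈ 𝒬, the ≪ h₁ h₂ h₃ triples thus account for ≪ h₁ h₂ h₃ log h₃ / log log h₃ values.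
-- If N = 0, write x₁ = g b and x₂ = g a with g = gcd(|x₁|, |x₂|): from x₁ ∣ x₂² we get b ∣ g,
-- so u ≡ a / b with 1 ≤ b ≤ h₁ and b |a| ≤ h₂, and there are ≪ h₂ log h₂ such pairs for each q.

open import Defs
open import Algebra.Properties.CommutativeSemigroup using (interchange)
open import Data.Bool using (T)
open import Data.Empty using (⊥-elim)
open import Data.Fin using (Fin; zero; suc; toℕ)
open import Data.Integer as ℤ using (ℤ; +_; -[1+_]; ∣_∣)
import Data.Integer.Divisibility.Signed as ℤ∣
import Data.Integer.Properties as ℤₚ
import Data.Integer.Tactic.RingSolver as ℤ-Solver
open import Data.List using (List; []; _∷_; _++_; length; map; concatMap; upTo; filter; cartesianProduct; allFin)
import Data.List.Properties as List
open import Data.List.Membership.Propositional using (_∈_; lose; find)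
open import Data.List.Membership.Propositional.Properties
  using (∈-map⁺; ∈-map⁻; ∈-++⁺ˡ; ∈-++⁺ʳ; ∈-++⁻; ∈-upTo⁺; ∈-upTo⁻; ∈-concatMap⁺; ∈-cartesianProduct⁺;
         ∈-cartesianProduct⁻; ∈-allFin; ∈-filter⁺; ∈-filter⁻)
open import Data.List.Relation.Unary.All using (All)
import Data.List.Relation.Unary.All as All
open import Data.List.Relation.Unary.All.Properties using (all⁺)
open import Data.List.Relation.Unary.AllPairs using (_∷_)
open import Data.List.Relation.Unary.Any using (here; there)
open import Data.List.Relation.Unary.Any.Properties using (any⁻)
open import Data.List.Relation.Unary.Unique.Propositional using (Unique)
open import Data.List.Relation.Unary.Unique.Propositional.Properties using (upTo⁺)
open import Data.Nat
  using (ℕ; zero; suc; _+_; _*_; _^_; _∸_; _≤_; _<_; _⊔_; _<?_; _≟_; _≤?_; z≤n; s≤s; s≤s⁻¹;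
         NonZero; ≢-nonZero; ≢-nonZero⁻¹; >-nonZero; ⌊_/2⌋)
open import Data.Nat.Coprimality using (Coprime; coprime-divisor; coprime-/gcd)
open import Data.Nat.Divisibility using (_∣_; _∣?_; divides; _∣0; ∣-trans; ∣⇒≤; >⇒∤; *-cancelʳ-∣)
open import Data.Nat.DivMod
  using (_/_; _%_; m≡m%n+[m/n]*n; m%n<n; m/n*n≡m; m/n*n≤m; m*n/n≡m; n/1≡n; /-monoˡ-≤; /-monoʳ-≤)
open import Data.Nat.GCD using (gcd; gcd[m,n]∣m; gcd[m,n]∣n; gcd[m,n]≢0)
open import Data.Nat.Induction using (<-wellFounded)
open import Data.Nat.ListAction using (sum)
open import Data.Nat.Logarithm using (⌊log₂_⌋; ⌊log₂⌋-mono-≤; ⌊log₂[2^n]⌋≡n)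
open import Data.Nat.Logarithm.Core using (⌊log2⌋)
open import Data.Nat.Primality using (Prime; euclidsLemma; prime⇒irreducible; ¬prime[1])
open import Data.Nat.Properties
import Data.Nat.Tactic.RingSolver as ℕ-Solver
open import Data.Product using (∃-syntax; ∃₂; _×_; _,_; proj₁; proj₂)
import Data.Product as Product
open import Data.Sum using (_⊎_; inj₁; inj₂; [_,_]′)
import Data.Sum as Sum
open import Function using (_∘_; _∘′_)
open import Induction.WellFounded using (Acc; acc)
open import Relation.Binary.Bundles using (Setoid)
open import Relation.Binary.PropositionalEquality
import Relation.Binary.Reasoning.Setoid as SetoidReasoning
open import Relation.Nullary using (Dec; yes; no; ¬_; ¬?)
open import Relation.Nullary.Decidable using (_×-dec_; map′; T?)
open import Relation.Unary using (Decidable)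

∑ : {A : Set} → List A → (A → ℕ) → ℕ
∑ []       f = 0
∑ (x ∷ xs) f = f x + ∑ xs f

module _ {A : Set} where

  sum-map : (f : A → ℕ) (xs : List A) → sum (map f xs) ≡ ∑ xs f
  sum-map f []       = refl
  sum-map f (x ∷ xs) = cong (_+_ (f x)) (sum-map f xs)

  ∑-cong : (xs : List A) {f g : A → ℕ} → (∀ {x} → x ∈ xs → f x ≡ g x) → ∑ xs f ≡ ∑ xs g
  ∑-cong []       eq = refl
  ∑-cong (x ∷ xs) eq = cong₂ _+_ (eq (here refl)) (∑-cong xs (eq ∘′ there))

  ∑-zero : (xs : List A) {f : A → ℕ} → (∀ {x} → x ∈ xs → f x ≡ 0) → ∑ xs f ≡ 0
  ∑-zero []       eq = refl
  ∑-zero (x ∷ xs) eq = cong₂ _+_ (eq (here refl)) (∑-zero xs (eq ∘′ there))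

  ∑-mono-≤ : (xs : List A) {f g : A → ℕ} → (∀ {x} → x ∈ xs → f x ≤ g x) → ∑ xs f ≤ ∑ xs g
  ∑-mono-≤ []       le = z≤n
  ∑-mono-≤ (x ∷ xs) le = +-mono-≤ (le (here refl)) (∑-mono-≤ xs (le ∘′ there))

  ∑≤length* : (xs : List A) {f : A → ℕ} {c : ℕ} → (∀ {x} → x ∈ xs → f x ≤ c) → ∑ xs f ≤ length xs * c
  ∑≤length* []       le = z≤n
  ∑≤length* (x ∷ xs) le = +-mono-≤ (le (here refl)) (∑≤length* xs (le ∘′ there))

  ≤-∑ : {xs : List A} {x : A} (f : A → ℕ) → x ∈ xs → f x ≤ ∑ xs f
  ≤-∑ {y ∷ xs} f (here refl) = m≤m+n (f y) (∑ xs f)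
  ≤-∑ {y ∷ xs} f (there x∈)  = ≤-trans (≤-∑ f x∈) (m≤n+m (∑ xs f) (f y))

  ∑-+ : (xs : List A) (f g : A → ℕ) → ∑ xs (λ x → f x + g x) ≡ ∑ xs f + ∑ xs g
  ∑-+ []       f g = refl
  ∑-+ (x ∷ xs) f g = trans (cong (_+_ (f x + g x)) (∑-+ xs f g)) (interchange +-commutativeSemigroup (f x) (g x) _ _)

  ∑-*ʳ : (xs : List A) (f : A → ℕ) (c : ℕ) → ∑ xs (λ x → f x * c) ≡ ∑ xs f * c
  ∑-*ʳ []       f c = refl
  ∑-*ʳ (x ∷ xs) f c = trans (cong (_+_ (f x * c)) (∑-*ʳ xs f c)) (sym (*-distribʳ-+ c (f x) (∑ xs f)))

  ∑-++ : (xs ys : List A) (f : A → ℕ) → ∑ (xs ++ ys) f ≡ ∑ xs f + ∑ ys f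
  ∑-++ []       ys f = refl
  ∑-++ (x ∷ xs) ys f = trans (cong (_+_ (f x)) (∑-++ xs ys f)) (sym (+-assoc (f x) (∑ xs f) (∑ ys f)))

∑-swap : {A B : Set} (xs : List A) (ys : List B) (f : A → B → ℕ) →
         ∑ xs (λ x → ∑ ys (f x)) ≡ ∑ ys (λ y → ∑ xs (λ x → f x y))
∑-swap []       ys f = sym (∑-zero ys (λ _ → refl))
∑-swap (x ∷ xs) ys f = trans (cong (_+_ (∑ ys (f x))) (∑-swap xs ys f)) (sym (∑-+ ys (f x) _))

∑-upTo-suc : ∀ n (f : ℕ → ℕ) → ∑ (upTo (suc n)) f ≡ ∑ (upTo n) f + f n
∑-upTo-suc n f = begin
  ∑ (upTo (suc n)) f        ≡⟨ cong (λ xs → ∑ xs f) (sym (List.upTo-∷ʳ n)) ⟩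
  ∑ (upTo n ++ n ∷ []) f    ≡⟨ ∑-++ (upTo n) (n ∷ []) f ⟩
  ∑ (upTo n) f + (f n + 0)  ≡⟨ cong (_+_ (∑ (upTo n) f)) (+-identityʳ (f n)) ⟩
  ∑ (upTo n) f + f n        ∎
  where open ≡-Reasoning

length-concatMap : {A B : Set} (f : A → List B) (xs : List A) → length (concatMap f xs) ≡ ∑ xs (length ∘ f)
length-concatMap f []       = refl
length-concatMap f (x ∷ xs) = trans (List.length-++ (f x)) (cong (_+_ (length (f x))) (length-concatMap f xs))

length-cartesianProduct : {A B : Set} (xs : List A) (ys : List B) →
                          length (cartesianProduct xs ys) ≡ length xs * length ys
length-cartesianProduct []       ys = refl
length-cartesianProduct (x ∷ xs) ys = begin
  length (map (x ,_) ys ++ cartesianProduct xs ys)          ≡⟨ List.length-++ (map (x ,_) ys) ⟩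
  length (map (x ,_) ys) + length (cartesianProduct xs ys)  ≡⟨ cong₂ _+_ (List.length-map (x ,_) ys) (length-cartesianProduct xs ys) ⟩
  length ys + length xs * length ys                         ∎
  where open ≡-Reasoning

𝟙 : {P : Set} → Dec P → ℕ
𝟙 (yes _) = 1
𝟙 (no _)  = 0

module _ {P : Set} where

  𝟙-yes : (d : Dec P) → P → 𝟙 d ≡ 1
  𝟙-yes (yes _) p = refl
  𝟙-yes (no ¬p) p = ⊥-elim (¬p p)

  𝟙-no : (d : Dec P) → ¬ P → 𝟙 d ≡ 0
  𝟙-no (yes p) ¬p = ⊥-elim (¬p p)
  𝟙-no (no _)  ¬p = refl

𝟙-mono : {P R : Set} (p : Dec P) (r : Dec R) → (P → R) → 𝟙 p ≤ 𝟙 r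
𝟙-mono (yes _) (yes _) _   = ≤-refl
𝟙-mono (yes p) (no ¬r) p⇒r = ⊥-elim (¬r (p⇒r p))
𝟙-mono (no _)  r       _   = z≤n

𝟙-⊎ : {P R S : Set} (p : Dec P) (r : Dec R) (s : Dec S) → (P → R ⊎ S) → 𝟙 p ≤ 𝟙 r + 𝟙 s
𝟙-⊎ (no _)  r       s       _ = z≤n
𝟙-⊎ (yes p) (yes _) s       _ = s≤s z≤n
𝟙-⊎ (yes p) (no ¬r) (yes _) _ = ≤-refl
𝟙-⊎ (yes p) (no ¬r) (no ¬s) split with split p
... | inj₁ r = ⊥-elim (¬r r)
... | inj₂ s = ⊥-elim (¬s s)

length-filter≡∑𝟙 : {A : Set} {P : A → Set} (P? : Decidable P) (xs : List A) → length (filter P? xs) ≡ ∑ xs (𝟙 ∘ P?)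
length-filter≡∑𝟙 P? []       = refl
length-filter≡∑𝟙 P? (x ∷ xs) with P? x
... | yes _ = cong suc (length-filter≡∑𝟙 P? xs)
... | no  _ = length-filter≡∑𝟙 P? xs

∑𝟙≤1 : {A : Set} {P : A → Set} (P? : Decidable P) {xs : List A} → Unique xs →
       (∀ {x y} → x ∈ xs → y ∈ xs → P x → P y → x ≡ y) → ∑ xs (𝟙 ∘ P?) ≤ 1
∑𝟙≤1 P? {[]}     _               _    = z≤n
∑𝟙≤1 P? {x ∷ xs} (x∉xs ∷ unique) same with P? x
... | no _   = ∑𝟙≤1 P? unique (λ x∈ y∈ → same (there x∈) (there y∈))
... | yes px = ≤-reflexive (cong suc (∑-zero xs (λ y∈ → 𝟙-no (P? _) (λ py → x≢y y∈ (same (here refl) (there y∈) px py)))))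
  where
  x≢y : ∀ {y} → y ∈ xs → x ≢ y
  x≢y = All.lookup x∉xs

count-below : {xs : List ℕ} → Unique xs → ∀ M → ∑ xs (λ x → 𝟙 (x <? M)) ≤ M
count-below {xs} unique zero    = ≤-reflexive (∑-zero xs (λ {x} _ → 𝟙-no (x <? 0) (λ ())))
count-below {xs} unique (suc M) = begin
  ∑ xs (λ x → 𝟙 (x <? suc M))
    ≤⟨ ∑-mono-≤ xs (λ _ → 𝟙-⊎ (_ <? suc M) (_ <? M) (_ ≟ M) m<1+n⇒m<n∨m≡n) ⟩
  ∑ xs (λ x → 𝟙 (x <? M) + 𝟙 (x ≟ M))
    ≡⟨ ∑-+ xs (λ x → 𝟙 (x <? M)) (λ x → 𝟙 (x ≟ M)) ⟩
  ∑ xs (λ x → 𝟙 (x <? M)) + ∑ xs (λ x → 𝟙 (x ≟ M))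
    ≤⟨ +-mono-≤ (count-below unique M) (∑𝟙≤1 (_≟ M) unique (λ _ _ x≡M y≡M → trans x≡M (sym y≡M))) ⟩
  M + 1
    ≡⟨ +-comm M 1 ⟩
  suc M
    ∎
  where open ≤-Reasoning

-- Binary logarithms and harmonic sums

⌊n/2⌋+⌊n/2⌋≤n : ∀ n → ⌊ n /2⌋ + ⌊ n /2⌋ ≤ n
⌊n/2⌋+⌊n/2⌋≤n zero          = z≤n
⌊n/2⌋+⌊n/2⌋≤n (suc zero)    = z≤n
⌊n/2⌋+⌊n/2⌋≤n (suc (suc n)) = s≤s (≤-trans (≤-reflexive (+-suc ⌊ n /2⌋ ⌊ n /2⌋)) (s≤s (⌊n/2⌋+⌊n/2⌋≤n n)))

n≤1+⌊n/2⌋+⌊n/2⌋ : ∀ n → n ≤ suc (⌊ n /2⌋ + ⌊ n /2⌋)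
n≤1+⌊n/2⌋+⌊n/2⌋ zero          = z≤n
n≤1+⌊n/2⌋+⌊n/2⌋ (suc zero)    = s≤s z≤n
n≤1+⌊n/2⌋+⌊n/2⌋ (suc (suc n)) = s≤s (≤-trans (s≤s (n≤1+⌊n/2⌋+⌊n/2⌋ n)) (≤-reflexive (sym (+-suc (suc ⌊ n /2⌋) ⌊ n /2⌋))))

n<2^n : ∀ n → n < 2 ^ n
n<2^n zero    = s≤s z≤n
n<2^n (suc n) = begin-strict
  suc n          <⟨ s≤s (n<2^n n) ⟩
  1 + 2 ^ n      ≤⟨ +-monoˡ-≤ (2 ^ n) (m^n>0 2 n) ⟩
  2 ^ n + 2 ^ n  ≡⟨ cong (_+_ (2 ^ n)) (sym (+-identityʳ (2 ^ n))) ⟩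
  2 ^ suc n      ∎
  where open ≤-Reasoning

2^m≤2^n⇒m≤n : ∀ {m n} → 2 ^ m ≤ 2 ^ n → m ≤ n
2^m≤2^n⇒m≤n {m} {n} le = subst₂ _≤_ (⌊log₂[2^n]⌋≡n m) (⌊log₂[2^n]⌋≡n n) (⌊log₂⌋-mono-≤ le)

n<2^suc⌊log₂n⌋ : ∀ n → n < 2 ^ suc ⌊log₂ n ⌋
n<2^suc⌊log₂n⌋ n = ≰⇒> (λ le → 1+n≰n (subst (_≤ ⌊log₂ n ⌋) (⌊log₂[2^n]⌋≡n (suc ⌊log₂ n ⌋)) (⌊log₂⌋-mono-≤ le)))

2^⌊log2⌋≤n : ∀ n (rec : Acc _<_ n) → 1 ≤ n → 2 ^ ⌊log2⌋ n rec ≤ n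
2^⌊log2⌋≤n (suc zero)    _        _ = ≤-refl
2^⌊log2⌋≤n (suc (suc k)) (acc rs) _ = begin
  2 * 2 ^ ⌊log2⌋ (suc h) _  ≤⟨ *-monoʳ-≤ 2 (2^⌊log2⌋≤n (suc h) _ (s≤s z≤n)) ⟩
  2 * suc h                 ≡⟨ trans (*-suc 2 h) (cong (_+_ 2) (cong (_+_ h) (+-identityʳ h))) ⟩
  2 + (h + h)               ≤⟨ +-monoʳ-≤ 2 (⌊n/2⌋+⌊n/2⌋≤n k) ⟩
  2 + k                     ∎
  where
  open ≤-Reasoning
  h = ⌊ k /2⌋

2^⌊log₂n⌋≤n : ∀ n → 1 ≤ n → 2 ^ ⌊log₂ n ⌋ ≤ n
2^⌊log₂n⌋≤n n = 2^⌊log2⌋≤n n (<-wellFounded n)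

≤2*H²⇒≤2^[3+2L] : ∀ {N} H → N ≤ 2 * (H * H) → N ≤ 2 ^ suc (suc (L H) + suc (L H))
≤2*H²⇒≤2^[3+2L] {N} H N≤2H² = begin
  N                            ≤⟨ N≤2H² ⟩
  2 * (H * H)                  ≤⟨ *-monoʳ-≤ 2 (*-mono-≤ H≤2^[1+L] H≤2^[1+L]) ⟩
  2 * (2 ^ suc ℓ * 2 ^ suc ℓ)  ≡⟨ cong (2 *_) (sym (^-distribˡ-+-* 2 (suc ℓ) (suc ℓ))) ⟩
  2 ^ suc (suc ℓ + suc ℓ)      ∎
  where
  open ≤-Reasoning
  ℓ = L H
  H≤2^[1+L] : H ≤ 2 ^ suc ℓ
  H≤2^[1+L] = ≤-trans (<⇒≤ (n<2^suc⌊log₂n⌋ H)) (^-monoʳ-≤ 2 (s≤s (m≤n⊔m 1 ⌊log₂ H ⌋)))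

1⊔n≤2*[1+⌊n/2⌋] : ∀ n → 1 ⊔ n ≤ 2 * suc ⌊ n /2⌋
1⊔n≤2*[1+⌊n/2⌋] n = ⊔-lub (s≤s z≤n) (≤-trans (n≤1+⌊n/2⌋+⌊n/2⌋ n) (≤-trans (n≤1+n _) (≤-reflexive 2+[h+h]≡2*[1+h])))
  where
  h = ⌊ n /2⌋
  2+[h+h]≡2*[1+h] : 2 + (h + h) ≡ 2 * suc h
  2+[h+h]≡2*[1+h] = sym (trans (*-suc 2 h) (cong (λ x → 2 + (h + x)) (+-identityʳ h)))

2^[1+⌊n/2⌋]*[1⊔n]≤4*2^n : ∀ n → 2 ^ suc ⌊ n /2⌋ * (1 ⊔ n) ≤ 4 * 2 ^ n
2^[1+⌊n/2⌋]*[1⊔n]≤4*2^n n = begin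
  2 ^ suc h * (1 ⊔ n)      ≤⟨ *-monoʳ-≤ (2 ^ suc h) (1⊔n≤2*[1+⌊n/2⌋] n) ⟩
  2 ^ suc h * (2 * suc h)  ≤⟨ *-monoʳ-≤ (2 ^ suc h) (*-monoʳ-≤ 2 (n<2^n h)) ⟩
  2 * 2 ^ h * (2 * 2 ^ h)  ≡⟨ identity (2 ^ h) ⟩
  4 * (2 ^ h * 2 ^ h)      ≡⟨ cong (4 *_) (sym (^-distribˡ-+-* 2 h h)) ⟩
  4 * 2 ^ (h + h)          ≤⟨ *-monoʳ-≤ 4 (^-monoʳ-≤ 2 (⌊n/2⌋+⌊n/2⌋≤n n)) ⟩
  4 * 2 ^ n                ∎
  where
  open ≤-Reasoning
  h = ⌊ n /2⌋
  identity : ∀ a → 2 * a * (2 * a) ≡ 4 * (a * a)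
  identity = ℕ-Solver.solve-∀

harmonic : ℕ → ℕ → ℕ
harmonic H n = ∑ (upTo n) (λ b → H / suc b)

harmonic-+ : ∀ H m j → harmonic H (m + j) ≤ harmonic H m + j * (H / suc m)
harmonic-+ H m zero    = ≤-reflexive (trans (cong (harmonic H) (+-identityʳ m)) (sym (+-identityʳ _)))
harmonic-+ H m (suc j) = begin
  harmonic H (m + suc j)                        ≡⟨ trans (cong (harmonic H) (+-suc m j)) (∑-upTo-suc (m + j) _) ⟩
  harmonic H (m + j) + H / suc (m + j)          ≤⟨ +-mono-≤ (harmonic-+ H m j) (/-monoʳ-≤ H (s≤s (m≤m+n m j))) ⟩
  harmonic H m + j * (H / suc m) + H / suc m    ≡⟨ +-assoc (harmonic H m) _ _ ⟩
  harmonic H m + (j * (H / suc m) + H / suc m)  ≡⟨ cong (_+_ (harmonic H m)) (+-comm (j * (H / suc m)) _) ⟩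
  harmonic H m + suc j * (H / suc m)            ∎
  where open ≤-Reasoning

-- Dyadic step: with m = 1 + ⌊k/2⌋, the j ≤ m + 1 terms H / (b + 1) with m ≤ b < k + 2 add up to at most H.
harmonic-acc≤ : ∀ H n (rec : Acc _<_ n) → harmonic H n ≤ H * suc (⌊log2⌋ n rec)
harmonic-acc≤ H zero          _        = z≤n
harmonic-acc≤ H (suc zero)    _        = ≤-reflexive (trans (+-identityʳ (H / 1)) (trans (n/1≡n H) (sym (*-identityʳ H))))
harmonic-acc≤ H (suc (suc k)) (acc rs) = begin
  harmonic H (suc (suc k))        ≡⟨ cong (harmonic H) (sym m+j≡2+k) ⟩
  harmonic H (m + j)              ≤⟨ harmonic-+ H m j ⟩
  harmonic H m + j * (H / suc m)  ≤⟨ +-mono-≤ (harmonic-acc≤ H m _) j*[H/1+m]≤H ⟩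
  H * suc (⌊log2⌋ m _) + H        ≡⟨ +-comm (H * _) H ⟩
  H + H * suc (⌊log2⌋ m _)        ≡⟨ sym (*-suc H _) ⟩
  H * suc (suc (⌊log2⌋ m _))      ∎
  where
  open ≤-Reasoning
  h = ⌊ k /2⌋
  m = suc h
  j = suc k ∸ h
  m+j≡2+k : m + j ≡ suc (suc k)
  m+j≡2+k = cong suc (m+[n∸m]≡n (≤-trans (⌊n/2⌋≤n k) (n≤1+n k)))
  j≤1+m : j ≤ suc m
  j≤1+m = m≤n+o⇒m∸n≤o (suc k) h (≤-trans (s≤s (n≤1+⌊n/2⌋+⌊n/2⌋ k)) (≤-reflexive (sym (trans (+-suc h (suc h)) (cong suc (+-suc h h))))))
  j*[H/1+m]≤H : j * (H / suc m) ≤ H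
  j*[H/1+m]≤H = ≤-trans (*-monoˡ-≤ (H / suc m) j≤1+m) (≤-trans (≤-reflexive (*-comm (suc m) (H / suc m))) (m/n*n≤m H (suc m)))

harmonic≤ : ∀ H n → harmonic H n ≤ H * suc ⌊log₂ n ⌋
harmonic≤ H n = harmonic-acc≤ H n (<-wellFounded n)

-- Counting prime divisors

prime-∣-cofactor : ∀ {p q} n → Prime p → Prime q → q ≢ p → p ∣ n * q → p ∣ n
prime-∣-cofactor n pp pq q≢p p∣nq with euclidsLemma n _ pp p∣nq
... | inj₁ p∣n = p∣n
... | inj₂ p∣q with prime⇒irreducible pq p∣q
...   | inj₁ p≡1 = ⊥-elim (¬prime[1] (subst Prime p≡1 pp))
...   | inj₂ p≡q = ⊥-elim (q≢p (sym p≡q))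

1≤m*n⇒1≤m : ∀ m {n} → 1 ≤ m * n → 1 ≤ m
1≤m*n⇒1≤m (suc m) _ = s≤s z≤n

large-prime-divisors : ∀ M .{{_ : NonZero M}} {Q : List ℕ} → Unique Q → All Prime Q →
                       ∀ {N} → 1 ≤ N → M ^ ∑ Q (λ q → 𝟙 (q ∣? N ×-dec M ≤? q)) ≤ N
large-prime-divisors M {[]}    _              _                 1≤N = 1≤N
large-prime-divisors M {q ∷ Q} (q∉Q ∷ unique) (pq All.∷ primes) {N} 1≤N with q ∣? N ×-dec M ≤? q
... | no _ = large-prime-divisors M unique primes 1≤N
... | yes (divides N′ N≡N′q , M≤q) = begin
  M * M ^ ∑ Q (λ x → 𝟙 (x ∣? N ×-dec M ≤? x))   ≤⟨ *-mono-≤ M≤q (^-monoʳ-≤ M (∑-mono-≤ Q cofactor)) ⟩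
  q * M ^ ∑ Q (λ x → 𝟙 (x ∣? N′ ×-dec M ≤? x))  ≤⟨ *-monoʳ-≤ q (large-prime-divisors M unique primes 1≤N′) ⟩
  q * N′                                        ≡⟨ trans (*-comm q N′) (sym N≡N′q) ⟩
  N                                             ∎
  where
  open ≤-Reasoning
  1≤N′ : 1 ≤ N′
  1≤N′ = 1≤m*n⇒1≤m N′ (subst (1 ≤_) N≡N′q 1≤N)
  cofactor : ∀ {x} → x ∈ Q → 𝟙 (x ∣? N ×-dec M ≤? x) ≤ 𝟙 (x ∣? N′ ×-dec M ≤? x)
  cofactor x∈Q = 𝟙-mono (_ ∣? N ×-dec M ≤? _) (_ ∣? N′ ×-dec M ≤? _)
    (Product.map₁ (prime-∣-cofactor N′ (All.lookup primes x∈Q) pq (All.lookup q∉Q x∈Q) ∘ subst (_ ∣_) N≡N′q))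

divisor-count-split : {Q : List ℕ} → Unique Q → ∀ N M →
                      ∑ Q (λ q → 𝟙 (q ∣? N)) ≤ M + ∑ Q (λ q → 𝟙 (q ∣? N ×-dec M ≤? q))
divisor-count-split {Q} unique N M = begin
  ∑ Q (λ q → 𝟙 (q ∣? N))
    ≤⟨ ∑-mono-≤ Q (λ _ → 𝟙-⊎ (_ ∣? N) (_ <? M) (_ ∣? N ×-dec M ≤? _) small-or-large) ⟩
  ∑ Q (λ q → 𝟙 (q <? M) + 𝟙 (q ∣? N ×-dec M ≤? q))
    ≡⟨ ∑-+ Q (λ q → 𝟙 (q <? M)) (λ q → 𝟙 (q ∣? N ×-dec M ≤? q)) ⟩
  ∑ Q (λ q → 𝟙 (q <? M)) + ∑ Q (λ q → 𝟙 (q ∣? N ×-dec M ≤? q))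
    ≤⟨ +-monoˡ-≤ _ (count-below unique M) ⟩
  M + ∑ Q (λ q → 𝟙 (q ∣? N ×-dec M ≤? q))
    ∎
  where
  open ≤-Reasoning
  small-or-large : ∀ {q} → q ∣ N → q < M ⊎ (q ∣ N × M ≤ q)
  small-or-large {q} q∣N = Sum.map₂ (q∣N ,_) (<-≤-connex q M)

-- At most M of the primes lie below M = 2 ^ (1 + ⌊j/2⌋) ≈ √(log H), and each one above M
-- costs a factor M of N ≤ 2H².
prime-divisor-count : {Q : List ℕ} → Unique Q → All Prime Q → ∀ {N} H → 1 ≤ N → N ≤ 2 * (H * H) →
                      ∑ Q (λ q → 𝟙 (q ∣? N)) * LL H ≤ 14 * L H
prime-divisor-count {Q} unique primes {N} H 1≤N N≤2H² = begin
  ∑ Q (λ q → 𝟙 (q ∣? N)) * LL H    ≤⟨ *-monoˡ-≤ (LL H) (divisor-count-split unique N M) ⟩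
  (M + k) * LL H                   ≡⟨ *-distribʳ-+ (LL H) M k ⟩
  M * LL H + k * LL H              ≤⟨ +-mono-≤ M*LL≤4ℓ k*LL≤2E ⟩
  4 * ℓ + 2 * suc (suc ℓ + suc ℓ)  ≤⟨ arith ℓ (m≤m⊔n 1 ⌊log₂ H ⌋) ⟩
  14 * ℓ                           ∎
  where
  open ≤-Reasoning
  ℓ = L H
  j = ⌊log₂ ℓ ⌋
  i = ⌊ j /2⌋
  M = 2 ^ suc i
  k = ∑ Q (λ q → 𝟙 (q ∣? N ×-dec M ≤? q))
  M*LL≤4ℓ : M * LL H ≤ 4 * ℓ
  M*LL≤4ℓ = ≤-trans (2^[1+⌊n/2⌋]*[1⊔n]≤4*2^n j) (*-monoʳ-≤ 4 (2^⌊log₂n⌋≤n ℓ (m≤m⊔n 1 ⌊log₂ H ⌋)))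
  [1+i]*k≤E : suc i * k ≤ suc (suc ℓ + suc ℓ)
  [1+i]*k≤E = 2^m≤2^n⇒m≤n (begin
    2 ^ (suc i * k)          ≡⟨ sym (^-*-assoc 2 (suc i) k) ⟩
    M ^ k                    ≤⟨ large-prime-divisors M {{m^n≢0 2 (suc i)}} unique primes 1≤N ⟩
    N                        ≤⟨ ≤2*H²⇒≤2^[3+2L] H N≤2H² ⟩
    2 ^ suc (suc ℓ + suc ℓ)  ∎)
  k*LL≤2E : k * LL H ≤ 2 * suc (suc ℓ + suc ℓ)
  k*LL≤2E = begin
    k * LL H                 ≤⟨ *-monoʳ-≤ k (1⊔n≤2*[1+⌊n/2⌋] j) ⟩
    k * (2 * suc i)          ≡⟨ trans (*-comm k (2 * suc i)) (*-assoc 2 (suc i) k) ⟩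
    2 * (suc i * k)          ≤⟨ *-monoʳ-≤ 2 [1+i]*k≤E ⟩
    2 * suc (suc ℓ + suc ℓ)  ∎
  arith : ∀ n → 1 ≤ n → 4 * n + 2 * suc (suc n + suc n) ≤ 14 * n
  arith (suc n) _ = ≤-trans (m≤m+n _ (6 * n)) (≤-reflexive (identity n))
    where
    identity : ∀ n → 4 * suc n + 2 * suc (suc (suc n) + suc (suc n)) + 6 * n ≡ 14 * suc n
    identity = ℕ-Solver.solve-∀

-- Congruences modulo q

infix 4 _≡_mod_

-- A record rather than a definition, so that unification can recover x and y from a proof.
record _≡_mod_ (x y : ℤ) (q : ℕ) : Set where
  constructor mod-by
  field q∣x-y : + q ℤ∣.∣ x ℤ.- y

open _≡_mod_ using (q∣x-y)

module _ {q : ℕ} where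

  ≡⇒≡-mod : ∀ {x y} → x ≡ y → x ≡ y mod q
  ≡⇒≡-mod {x} refl = mod-by (ℤ∣.divides (+ 0) (ℤₚ.+-inverseʳ x))

  ≡-mod-sym : ∀ {x y} → x ≡ y mod q → y ≡ x mod q
  ≡-mod-sym {x} {y} (mod-by q∣x-y) = mod-by (subst (+ q ℤ∣.∣_) (identity x y) (ℤ∣.∣m⇒∣-m q∣x-y))
    where
    identity : ∀ x y → ℤ.- (x ℤ.- y) ≡ y ℤ.- x
    identity = ℤ-Solver.solve-∀

  ≡-mod-trans : ∀ {x y z} → x ≡ y mod q → y ≡ z mod q → x ≡ z mod q
  ≡-mod-trans {x} {y} {z} (mod-by q∣x-y) (mod-by q∣y-z) =
    mod-by (subst (+ q ℤ∣.∣_) (identity x y z) (ℤ∣.∣m∣n⇒∣m+n q∣x-y q∣y-z))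
    where
    identity : ∀ x y z → x ℤ.- y ℤ.+ (y ℤ.- z) ≡ x ℤ.- z
    identity = ℤ-Solver.solve-∀

  -‿cong-mod : ∀ {x y} → x ≡ y mod q → ℤ.- x ≡ ℤ.- y mod q
  -‿cong-mod {x} {y} (mod-by q∣x-y) = mod-by (subst (+ q ℤ∣.∣_) (identity x y) (ℤ∣.∣m⇒∣-m q∣x-y))
    where
    identity : ∀ x y → ℤ.- (x ℤ.- y) ≡ ℤ.- x ℤ.- ℤ.- y
    identity = ℤ-Solver.solve-∀

  *-congˡ-mod : ∀ x {y z} → y ≡ z mod q → x ℤ.* y ≡ x ℤ.* z mod q
  *-congˡ-mod x {y} {z} (mod-by q∣y-z) = mod-by (subst (+ q ℤ∣.∣_) (identity x y z) (ℤ∣.∣n⇒∣m*n x q∣y-z))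
    where
    identity : ∀ x y z → x ℤ.* (y ℤ.- z) ≡ x ℤ.* y ℤ.- x ℤ.* z
    identity = ℤ-Solver.solve-∀

  *-cong-mod : ∀ {x x′ y y′} → x ≡ x′ mod q → y ≡ y′ mod q → x ℤ.* y ≡ x′ ℤ.* y′ mod q
  *-cong-mod {x} {x′} {y} {y′} x≡x′ y≡y′ = ≡-mod-trans
    (subst₂ (λ a b → a ≡ b mod q) (ℤₚ.*-comm y x) (ℤₚ.*-comm y x′) (*-congˡ-mod y x≡x′))
    (*-congˡ-mod x′ y≡y′)

  ≡-mod-setoid : Setoid _ _
  ≡-mod-setoid = record
    { Carrier       = ℤ
    ; _≈_           = λ x y → x ≡ y mod q
    ; isEquivalence = record { refl = ≡⇒≡-mod refl ; sym = ≡-mod-sym ; trans = ≡-mod-trans }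
    }

module ≡-mod-Reasoning (q : ℕ) = SetoidReasoning (≡-mod-setoid {q})

∣-resp-≡-mod : ∀ {q x y} → x ≡ y mod q → q ∣ ∣ y ∣ → q ∣ ∣ x ∣
∣-resp-≡-mod {q} {x} {y} (mod-by q∣x-y) q∣y =
  ℤ∣.∣⇒∣ᵤ (subst (+ q ℤ∣.∣_) (identity x y) (ℤ∣.∣m∣n⇒∣m+n q∣x-y (ℤ∣.∣ᵤ⇒∣ q∣y)))
  where
  identity : ∀ x y → x ℤ.- y ℤ.+ y ≡ x
  identity = ℤ-Solver.solve-∀

∣∧<⇒≡0 : ∀ {q n} → n < q → q ∣ n → n ≡ 0
∣∧<⇒≡0 {n = zero}  _   _   = refl
∣∧<⇒≡0 {n = suc n} n<q q∣n = ⊥-elim (>⇒∤ n<q q∣n)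

≡-mod⇒≡ : ∀ {q u v} → u < q → v < q → + u ≡ + v mod q → u ≡ v
≡-mod⇒≡ {q} {u} {v} u<q v<q (mod-by q∣u-v) =
  ℤₚ.+-injective (ℤₚ.i-j≡0⇒i≡j (+ u) (+ v) (ℤₚ.∣i∣≡0⇒i≡0 (∣∧<⇒≡0 ∣u-v∣<q (ℤ∣.∣⇒∣ᵤ q∣u-v))))
  where
  ∣u-v∣<q : ∣ + u ℤ.- + v ∣ < q
  ∣u-v∣<q = ≤-<-trans (≤-trans (≤-reflexive (cong ∣_∣ (ℤₚ.m-n≡m⊖n u v))) (ℤₚ.∣m⊝n∣≤m⊔n u v)) (⊔-lub u<q v<q)

*-cancelʳ-mod : ∀ {q x y c} → Prime q → ¬ q ∣ ∣ c ∣ → x ℤ.* c ≡ y ℤ.* c mod q → x ≡ y mod q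
*-cancelʳ-mod {q} {x} {y} {c} pq q∤c (mod-by q∣xc-yc) =
  [ mod-by ∘ ℤ∣.∣ᵤ⇒∣ , ⊥-elim ∘ q∤c ]′ (euclidsLemma ∣ x ℤ.- y ∣ ∣ c ∣ pq q∣∣x-y∣*∣c∣)
  where
  identity : ∀ x y c → x ℤ.* c ℤ.- y ℤ.* c ≡ (x ℤ.- y) ℤ.* c
  identity = ℤ-Solver.solve-∀
  q∣∣x-y∣*∣c∣ : q ∣ ∣ x ℤ.- y ∣ * ∣ c ∣
  q∣∣x-y∣*∣c∣ = subst (q ∣_) (trans (cong ∣_∣ (identity x y c)) (ℤₚ.abs-* (x ℤ.- y) c)) (ℤ∣.∣⇒∣ᵤ q∣xc-yc)

+[r+k*q]≡+r+k*+q : ∀ r k q → + (r + k * q) ≡ + r ℤ.+ + k ℤ.* + q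
+[r+k*q]≡+r+k*+q r k q = trans (ℤₚ.pos-+ r (k * q)) (cong (ℤ._+_ (+ r)) (ℤₚ.pos-* k q))

r+k*q≡r-mod-q : ∀ r k q → + (r + k * q) ≡ + r mod q
r+k*q≡r-mod-q r k q = mod-by (ℤ∣.divides (+ k) (trans (cong (ℤ._- + r) (+[r+k*q]≡+r+k*+q r k q)) (identity (+ r) (+ k) (+ q))))
  where
  identity : ∀ r k q → r ℤ.+ k ℤ.* q ℤ.- r ≡ k ℤ.* q
  identity = ℤ-Solver.solve-∀

r+k*q≡r-q-mod-q : ∀ r k q → + (r + k * q) ≡ + r ℤ.- + q mod q
r+k*q≡r-q-mod-q r k q =
  mod-by (ℤ∣.divides (+ k ℤ.+ ℤ.1ℤ) (trans (cong (ℤ._- (+ r ℤ.- + q)) (+[r+k*q]≡+r+k*+q r k q)) (identity (+ r) (+ k) (+ q))))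
  where
  identity : ∀ r k q → r ℤ.+ k ℤ.* q ℤ.- (r ℤ.- q) ≡ (k ℤ.+ ℤ.1ℤ) ℤ.* q
  identity = ℤ-Solver.solve-∀

nearest-residue : ∀ p m {H} → distq p m ≤ H → ∃[ x ] (∣ x ∣ ≤ H × + m ≡ x mod suc p)
nearest-residue p m {H} dist≤H with ≤-total (m % suc p) (suc p ∸ m % suc p)
... | inj₁ r≤q∸r = + (m % suc p) ,
      ≤-trans (≤-reflexive (sym (m≤n⇒m⊓n≡m r≤q∸r))) dist≤H ,
      subst (λ n → + n ≡ + (m % suc p) mod suc p) (sym (m≡m%n+[m/n]*n m (suc p)))
        (r+k*q≡r-mod-q (m % suc p) (m / suc p) (suc p))
... | inj₂ q∸r≤r = + (m % suc p) ℤ.- + suc p ,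
      ≤-trans (≤-reflexive ∣r-q∣≡q∸r) (≤-trans (≤-reflexive (sym (m≥n⇒m⊓n≡n q∸r≤r))) dist≤H) ,
      subst (λ n → + n ≡ + (m % suc p) ℤ.- + suc p mod suc p) (sym (m≡m%n+[m/n]*n m (suc p)))
        (r+k*q≡r-q-mod-q (m % suc p) (m / suc p) (suc p))
  where
  ∣r-q∣≡q∸r : ∣ + (m % suc p) ℤ.- + suc p ∣ ≡ suc p ∸ m % suc p
  ∣r-q∣≡q∸r = trans (cong ∣_∣ (ℤₚ.m-n≡m⊖n (m % suc p) (suc p))) (ℤₚ.∣⊖∣-≤ (<⇒≤ (m%n<n m (suc p))))

Ratio : ℕ → ℤ → ℤ → ℕ → Set
Ratio q a b u = ¬ q ∣ ∣ b ∣ × + u ℤ.* b ≡ a mod q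

ratio? : ∀ q a b → Decidable (Ratio q a b)
ratio? q a b u = ¬? (q ∣? ∣ b ∣) ×-dec map′ mod-by q∣x-y (+ q ℤ∣.∣? + u ℤ.* b ℤ.- a)

ratio-unique : ∀ {q a b u v} → Prime q → u < q → v < q → Ratio q a b u → Ratio q a b v → u ≡ v
ratio-unique pq u<q v<q (q∤b , ub≡a) (_ , vb≡a) =
  ≡-mod⇒≡ u<q v<q (*-cancelʳ-mod pq q∤b (≡-mod-trans ub≡a (≡-mod-sym vb≡a)))

∑-ratio≤1 : ∀ {q} a b → Prime q → ∑ (upTo q) (𝟙 ∘ ratio? q a b) ≤ 1
∑-ratio≤1 {q} a b pq = ∑𝟙≤1 (ratio? q a b) (upTo⁺ q) (λ u∈ v∈ → ratio-unique pq (∈-upTo⁻ u∈) (∈-upTo⁻ v∈))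

pos-^ : ∀ m k → + (m ^ k) ≡ (+ m) ℤ.^ k
pos-^ m zero    = refl
pos-^ m (suc k) = trans (ℤₚ.pos-* m (m ^ k)) (cong (ℤ._*_ (+ m)) (pos-^ m k))

progression-ratio : ∀ {q} σ υ {x₁ x₂} → σ ℤ.* υ ℤ.^ 1 ≡ x₁ mod q → σ ℤ.* υ ℤ.^ 2 ≡ x₂ mod q →
                    υ ℤ.* x₁ ≡ x₂ mod q
progression-ratio {q} σ υ {x₁} {x₂} e₁ e₂ = begin
  υ ℤ.* x₁               ≈⟨ *-congˡ-mod υ (≡-mod-sym e₁) ⟩
  υ ℤ.* (σ ℤ.* υ ℤ.^ 1)  ≡⟨ identity σ υ ⟩
  σ ℤ.* υ ℤ.^ 2          ≈⟨ e₂ ⟩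
  x₂                     ∎
  where
  open ≡-mod-Reasoning q
  identity : ∀ σ υ → υ ℤ.* (σ ℤ.* (υ ℤ.* ℤ.1ℤ)) ≡ σ ℤ.* (υ ℤ.* (υ ℤ.* ℤ.1ℤ))
  identity = ℤ-Solver.solve-∀

progression-square : ∀ {q} σ υ {x₁ x₂ x₃} → σ ℤ.* υ ℤ.^ 1 ≡ x₁ mod q → σ ℤ.* υ ℤ.^ 2 ≡ x₂ mod q →
                     σ ℤ.* υ ℤ.^ 3 ≡ x₃ mod q → x₁ ℤ.* x₃ ≡ x₂ ℤ.* x₂ mod q
progression-square {q} σ υ {x₁} {x₂} {x₃} e₁ e₂ e₃ = begin
  x₁ ℤ.* x₃                            ≈⟨ *-cong-mod (≡-mod-sym e₁) (≡-mod-sym e₃) ⟩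
  (σ ℤ.* υ ℤ.^ 1) ℤ.* (σ ℤ.* υ ℤ.^ 3)  ≡⟨ identity σ υ ⟩
  (σ ℤ.* υ ℤ.^ 2) ℤ.* (σ ℤ.* υ ℤ.^ 2)  ≈⟨ *-cong-mod e₂ e₂ ⟩
  x₂ ℤ.* x₂                            ∎
  where
  open ≡-mod-Reasoning q
  identity : ∀ σ υ → (σ ℤ.* (υ ℤ.* ℤ.1ℤ)) ℤ.* (σ ℤ.* (υ ℤ.* (υ ℤ.* (υ ℤ.* ℤ.1ℤ))))
                     ≡ (σ ℤ.* (υ ℤ.* (υ ℤ.* ℤ.1ℤ))) ℤ.* (σ ℤ.* (υ ℤ.* (υ ℤ.* ℤ.1ℤ)))
  identity = ℤ-Solver.solve-∀

prime∤* : ∀ {q s u} → Prime q → 0 < s → s < q → 0 < u → u < q → ¬ q ∣ s * u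
prime∤* {q} {s} {u} pq 0<s s<q 0<u u<q q∣su = [ small 0<s s<q , small 0<u u<q ]′ (euclidsLemma s u pq q∣su)
  where
  small : ∀ {n} → 0 < n → n < q → ¬ q ∣ n
  small 0<n n<q q∣n = <⇒≢ 0<n (sym (∣∧<⇒≡0 n<q q∣n))

range : ℕ → List ℤ
range H = map +_ (upTo (suc H)) ++ map -[1+_] (upTo H)

∈-range⁺ : ∀ {H} x → ∣ x ∣ ≤ H → x ∈ range H
∈-range⁺ (+ n)    n≤H = ∈-++⁺ˡ (∈-map⁺ +_ (∈-upTo⁺ (s≤s n≤H)))
∈-range⁺ -[1+ n ] n<H = ∈-++⁺ʳ _ (∈-map⁺ -[1+_] (∈-upTo⁺ n<H))

∈-range⁻ : ∀ {H} x → x ∈ range H → ∣ x ∣ ≤ H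
∈-range⁻ {H} x x∈ with ∈-++⁻ (map +_ (upTo (suc H))) x∈
... | inj₁ x∈⁺ with ∈-map⁻ +_ x∈⁺
...   | _ , n∈ , refl = s≤s⁻¹ (∈-upTo⁻ n∈)
∈-range⁻ {H} x x∈ | inj₂ x∈⁻ with ∈-map⁻ -[1+_] x∈⁻
...   | _ , n∈ , refl = ∈-upTo⁻ n∈

length-range : ∀ H → length (range H) ≡ suc (H + H)
length-range H = begin
  length (map +_ (upTo (suc H)) ++ map -[1+_] (upTo H))          ≡⟨ List.length-++ (map +_ (upTo (suc H))) ⟩
  length (map +_ (upTo (suc H))) + length (map -[1+_] (upTo H))  ≡⟨ cong₂ _+_ (List.length-map +_ (upTo (suc H))) (List.length-map -[1+_] (upTo H)) ⟩
  length (upTo (suc H)) + length (upTo H)                        ≡⟨ cong₂ _+_ (List.length-upTo (suc H)) (List.length-upTo H) ⟩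
  suc (H + H)                                                    ∎
  where open ≡-Reasoning

pairs : ℕ → ℕ → List (ℤ × ℤ)
pairs H₁ H₂ = concatMap (λ b → map (λ a → a , + suc b) (range (H₂ / suc b))) (upTo H₁)

∈-pairs⁺ : ∀ {H₁ H₂ b} a → b < H₁ → ∣ a ∣ ≤ H₂ / suc b → (a , + suc b) ∈ pairs H₁ H₂
∈-pairs⁺ a b<H₁ ∣a∣≤ = ∈-concatMap⁺ _ (lose (∈-upTo⁺ b<H₁) (∈-map⁺ _ (∈-range⁺ a ∣a∣≤)))

length-pairs : ∀ H₁ H₂ → length (pairs H₁ H₂) ≡ ∑ (upTo H₁) (λ b → suc (H₂ / suc b + H₂ / suc b))
length-pairs H₁ H₂ = trans (length-concatMap _ (upTo H₁))
  (∑-cong (upTo H₁) (λ {b} _ → trans (List.length-map _ (range (H₂ / suc b))) (length-range (H₂ / suc b))))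

1+length-pairs≤ : ∀ {H₁ H₂} → 1 ≤ H₁ → H₁ ≤ H₂ → 1 + length (pairs H₁ H₂) ≤ 6 * (H₂ * L H₂)
1+length-pairs≤ {H₁} {H₂} 1≤H₁ H₁≤H₂ = begin
  1 + length (pairs H₁ H₂)                                         ≡⟨ cong suc (length-pairs H₁ H₂) ⟩
  1 + ∑ (upTo H₁) (λ b → 1 + (H₂ / suc b + H₂ / suc b))            ≡⟨ cong suc (∑-+ (upTo H₁) (λ _ → 1) _) ⟩
  1 + (∑ (upTo H₁) (λ _ → 1) + ∑ (upTo H₁) (λ b → H₂ / suc b + H₂ / suc b))
                                                                   ≡⟨ cong (λ x → 1 + (∑ (upTo H₁) (λ _ → 1) + x)) (∑-+ (upTo H₁) _ _) ⟩
  1 + (∑ (upTo H₁) (λ _ → 1) + (harmonic H₂ H₁ + harmonic H₂ H₁))  ≤⟨ s≤s (+-mono-≤ ones (+-mono-≤ harmonic≤H₂ harmonic≤H₂)) ⟩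
  1 + (H₂ + (H₂ * suc ℓ + H₂ * suc ℓ))                             ≤⟨ arith H₂ ℓ (≤-trans 1≤H₁ H₁≤H₂) (m≤m⊔n 1 ⌊log₂ H₂ ⌋) ⟩
  6 * (H₂ * ℓ)                                                     ∎
  where
  open ≤-Reasoning
  ℓ = L H₂
  ones : ∑ (upTo H₁) (λ _ → 1) ≤ H₂
  ones = ≤-trans (∑≤length* (upTo H₁) (λ _ → ≤-refl))
           (≤-trans (≤-reflexive (trans (*-identityʳ _) (List.length-upTo H₁))) H₁≤H₂)
  harmonic≤H₂ : harmonic H₂ H₁ ≤ H₂ * suc ℓ
  harmonic≤H₂ = ≤-trans (harmonic≤ H₂ H₁) (*-monoʳ-≤ H₂ (s≤s (≤-trans (⌊log₂⌋-mono-≤ H₁≤H₂) (m≤n⊔m 1 _))))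
  arith : ∀ b l → 1 ≤ b → 1 ≤ l → 1 + (b + (b * suc l + b * suc l)) ≤ 6 * (b * l)
  arith (suc b) (suc l) _ _ = ≤-trans (m≤m+n _ (4 * b * l + b + 4 * l)) (≤-reflexive (identity b l))
    where
    identity : ∀ b l → 1 + (suc b + (suc b * suc (suc l) + suc b * suc (suc l))) + (4 * b * l + b + 4 * l)
                       ≡ 6 * (suc b * suc l)
    identity = ℕ-Solver.solve-∀

triples : ℕ → ℕ → ℕ → List (ℤ × ℤ × ℤ)
triples H₁ H₂ H₃ = cartesianProduct (range H₁) (cartesianProduct (range H₂) (range H₃))

∈-triples⁺ : ∀ {H₁ H₂ H₃} x₁ x₂ x₃ → ∣ x₁ ∣ ≤ H₁ → ∣ x₂ ∣ ≤ H₂ → ∣ x₃ ∣ ≤ H₃ → (x₁ , x₂ , x₃) ∈ triples H₁ H₂ H₃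
∈-triples⁺ x₁ x₂ x₃ b₁ b₂ b₃ = ∈-cartesianProduct⁺ (∈-range⁺ x₁ b₁) (∈-cartesianProduct⁺ (∈-range⁺ x₂ b₂) (∈-range⁺ x₃ b₃))

∈-triples⁻ : ∀ {H₁ H₂ H₃ x₁ x₂ x₃} → (x₁ , x₂ , x₃) ∈ triples H₁ H₂ H₃ → ∣ x₁ ∣ ≤ H₁ × ∣ x₂ ∣ ≤ H₂ × ∣ x₃ ∣ ≤ H₃
∈-triples⁻ {H₁} {H₂} {H₃} {x₁} {x₂} {x₃} t∈ =
  let x₁∈ , x₂₃∈ = ∈-cartesianProduct⁻ (range H₁) _ t∈
      x₂∈ , x₃∈  = ∈-cartesianProduct⁻ (range H₂) (range H₃) x₂₃∈
  in ∈-range⁻ x₁ x₁∈ , ∈-range⁻ x₂ x₂∈ , ∈-range⁻ x₃ x₃∈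

length-triples≤ : ∀ {H₁ H₂ H₃} → 1 ≤ H₁ → 1 ≤ H₂ → 1 ≤ H₃ → length (triples H₁ H₂ H₃) ≤ 3 * H₁ * (3 * H₂ * (3 * H₃))
length-triples≤ {H₁} {H₂} {H₃} 1≤H₁ 1≤H₂ 1≤H₃ = begin
  length (triples H₁ H₂ H₃)                                            ≡⟨ length-cartesianProduct (range H₁) (cartesianProduct (range H₂) (range H₃)) ⟩
  length (range H₁) * length (cartesianProduct (range H₂) (range H₃))  ≡⟨ cong₂ _*_ (length-range H₁) (length-cartesianProduct (range H₂) (range H₃)) ⟩
  suc (H₁ + H₁) * (length (range H₂) * length (range H₃))              ≡⟨ cong (suc (H₁ + H₁) *_) (cong₂ _*_ (length-range H₂) (length-range H₃)) ⟩
  suc (H₁ + H₁) * (suc (H₂ + H₂) * suc (H₃ + H₃))                      ≤⟨ *-mono-≤ (1+2H≤3H 1≤H₁) (*-mono-≤ (1+2H≤3H 1≤H₂) (1+2H≤3H 1≤H₃)) ⟩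
  3 * H₁ * (3 * H₂ * (3 * H₃))                                         ∎
  where
  open ≤-Reasoning
  1+2H≤3H : ∀ {H} → 1 ≤ H → suc (H + H) ≤ 3 * H
  1+2H≤3H {H} 1≤H = ≤-trans (≤-reflexive (+-comm 1 (H + H))) (≤-trans (+-monoʳ-≤ (H + H) 1≤H) (≤-reflexive (identity H)))
    where
    identity : ∀ H → H + H + H ≡ 3 * H
    identity = ℕ-Solver.solve-∀

norm : ℤ × ℤ × ℤ → ℤ
norm (x₁ , x₂ , x₃) = x₁ ℤ.* x₃ ℤ.- x₂ ℤ.* x₂

nondegenerate? : Decidable (λ t → norm t ≢ ℤ.0ℤ)
nondegenerate? t = ¬? (norm t ℤ.≟ ℤ.0ℤ)

nondegenerate-triples : ℕ → ℕ → ℕ → List (ℤ × ℤ × ℤ)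
nondegenerate-triples H₁ H₂ H₃ = filter nondegenerate? (triples H₁ H₂ H₃)

∣norm∣≤2*H² : ∀ {H x₁ x₂ x₃} → ∣ x₁ ∣ ≤ H → ∣ x₂ ∣ ≤ H → ∣ x₃ ∣ ≤ H → ∣ norm (x₁ , x₂ , x₃) ∣ ≤ 2 * (H * H)
∣norm∣≤2*H² {H} {x₁} {x₂} {x₃} b₁ b₂ b₃ = begin
  ∣ x₁ ℤ.* x₃ ℤ.- x₂ ℤ.* x₂ ∣        ≤⟨ ℤₚ.∣i-j∣≤∣i∣+∣j∣ (x₁ ℤ.* x₃) (x₂ ℤ.* x₂) ⟩
  ∣ x₁ ℤ.* x₃ ∣ + ∣ x₂ ℤ.* x₂ ∣      ≡⟨ cong₂ _+_ (ℤₚ.abs-* x₁ x₃) (ℤₚ.abs-* x₂ x₂) ⟩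
  ∣ x₁ ∣ * ∣ x₃ ∣ + ∣ x₂ ∣ * ∣ x₂ ∣  ≤⟨ +-mono-≤ (*-mono-≤ b₁ b₃) (*-mono-≤ b₂ b₂) ⟩
  H * H + H * H                      ≡⟨ cong (_+_ (H * H)) (sym (+-identityʳ (H * H))) ⟩
  2 * (H * H)                        ∎
  where open ≤-Reasoning

prime-divisors-of-norm : ∀ {Q H₁ H₂ H₃ t} → Unique Q → All Prime Q → H₁ ≤ H₃ → H₂ ≤ H₃ →
                         t ∈ nondegenerate-triples H₁ H₂ H₃ → ∑ Q (λ q → 𝟙 (q ∣? ∣ norm t ∣)) * LL H₃ ≤ 14 * L H₃
prime-divisors-of-norm {H₃ = H₃} {t = x₁ , x₂ , x₃} unique primes H₁≤H₃ H₂≤H₃ t∈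
  with ∈-filter⁻ nondegenerate? t∈
... | t∈triples , N≢0 with ∈-triples⁻ t∈triples
...   | b₁ , b₂ , b₃ = prime-divisor-count unique primes H₃
  (n≢0⇒n>0 (N≢0 ∘ ℤₚ.∣i∣≡0⇒i≡0)) (∣norm∣≤2*H² {x₁ = x₁} {x₂} {x₃} (≤-trans b₁ H₁≤H₃) (≤-trans b₂ H₂≤H₃) b₃)

-- Degenerate triples

coprime-divisor-of-square : ∀ {A B g} .{{_ : NonZero g}} → Coprime B A → B * g ∣ A * g * (A * g) → B ∣ g
coprime-divisor-of-square {A} {B} {g} B⊥A Bg∣[Ag]² =
  coprime-divisor B⊥A (coprime-divisor B⊥A (*-cancelʳ-∣ g (subst (B * g ∣_) (identity A g) Bg∣[Ag]²)))
  where
  identity : ∀ A g → A * g * (A * g) ≡ A * (A * g) * g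
  identity = ℕ-Solver.solve-∀

square-divisor : ∀ X Y .{{_ : NonZero X}} → X ∣ Y * Y → ∃₂ λ A B → ∃[ g ] (X ≡ B * g × Y ≡ A * g × B ∣ g)
square-divisor X Y X∣Y² = Y / g , X / g , g , sym X/g*g≡X , sym Y/g*g≡Y ,
  coprime-divisor-of-square (coprime-/gcd X Y) (subst₂ (λ x y → x ∣ y * y) (sym X/g*g≡X) (sym Y/g*g≡Y) X∣Y²)
  where
  g = gcd X Y
  instance
    g≢0 : NonZero g
    g≢0 = ≢-nonZero (gcd[m,n]≢0 X Y (inj₁ (≢-nonZero⁻¹ X)))
  X/g*g≡X : X / g * g ≡ X
  X/g*g≡X = m/n*n≡m (gcd[m,n]∣m X Y)
  Y/g*g≡Y : Y / g * g ≡ Y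
  Y/g*g≡Y = m/n*n≡m (gcd[m,n]∣n X Y)

∣y∣≡A*g⇒y≡a*g : ∀ y {A} g → ∣ y ∣ ≡ A * g → ∃[ a ] (∣ a ∣ ≡ A × y ≡ a ℤ.* + g)
∣y∣≡A*g⇒y≡a*g (+ n)    {A} g n≡Ag = + A , refl , trans (cong +_ n≡Ag) (ℤₚ.pos-* A g)
∣y∣≡A*g⇒y≡a*g -[1+ n ] {A} g n≡Ag = ℤ.- + A , ℤₚ.∣-i∣≡∣i∣ (+ A) ,
  trans (cong (ℤ.-_ ∘ +_) n≡Ag) (trans (cong ℤ.-_ (ℤₚ.pos-* A g)) (ℤₚ.neg-distribˡ-* (+ A) (+ g)))

positive-degenerate-pair : ∀ {q u X H₁ H₂} {y : ℤ} → Prime q → ¬ q ∣ X → 1 ≤ X → X ≤ H₁ → ∣ y ∣ ≤ H₂ →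
                           X ∣ ∣ y ∣ * ∣ y ∣ → + u ℤ.* + X ≡ y mod q →
                           ∃[ w ] (w ∈ pairs H₁ H₂ × Ratio q (proj₁ w) (proj₂ w) u)
positive-degenerate-pair {q} {u} {X@(suc _)} {H₁} {H₂} {y} pq q∤X _ X≤H₁ ∣y∣≤H₂ X∣y² uX≡y
  with square-divisor X ∣ y ∣ X∣y²
... | A , zero      , g , () , _ , _
... | A , B@(suc b) , g , X≡Bg , ∣y∣≡Ag , B∣g
  with ∣y∣≡A*g⇒y≡a*g y g ∣y∣≡Ag
...   | a , ∣a∣≡A , y≡ag = (a , + B) , ∈-pairs⁺ {H₂ = H₂} a b<H₁ ∣a∣≤H₂/B , q∤B , uB≡a
  where
  instance
    g≢0 : NonZero g
    g≢0 = >-nonZero (1≤m*n⇒1≤m g (subst (1 ≤_) (trans X≡Bg (*-comm B g)) (s≤s z≤n)))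
  b<H₁ : b < H₁
  b<H₁ = ≤-trans (≤-trans (m≤m*n B g) (≤-reflexive (sym X≡Bg))) X≤H₁
  ∣a∣≤H₂/B : ∣ a ∣ ≤ H₂ / B
  ∣a∣≤H₂/B = begin
    ∣ a ∣      ≡⟨ trans ∣a∣≡A (sym (m*n/n≡m A B)) ⟩
    A * B / B  ≤⟨ /-monoˡ-≤ B (≤-trans (*-monoʳ-≤ A (∣⇒≤ B∣g)) (≤-trans (≤-reflexive (sym ∣y∣≡Ag)) ∣y∣≤H₂)) ⟩
    H₂ / B     ∎
    where open ≤-Reasoning
  q∤B : ¬ q ∣ B
  q∤B q∣B = q∤X (∣-trans q∣B (divides g (trans X≡Bg (*-comm B g))))
  q∤g : ¬ q ∣ g
  q∤g q∣g = q∤X (∣-trans q∣g (divides B X≡Bg))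
  uB≡a : + u ℤ.* + B ≡ a mod q
  uB≡a = *-cancelʳ-mod pq q∤g (begin
    + u ℤ.* + B ℤ.* + g    ≡⟨ ℤₚ.*-assoc (+ u) (+ B) (+ g) ⟩
    + u ℤ.* (+ B ℤ.* + g)  ≡⟨ cong (ℤ._*_ (+ u)) (trans (sym (ℤₚ.pos-* B g)) (cong +_ (sym X≡Bg))) ⟩
    + u ℤ.* + X            ≈⟨ uX≡y ⟩
    y                      ≡⟨ y≡ag ⟩
    a ℤ.* + g              ∎)
    where open ≡-mod-Reasoning q

x₁x₃≡x₂²⇒∣x₁∣∣∣x₂∣² : ∀ {x₁ x₂ x₃} → x₁ ℤ.* x₃ ≡ x₂ ℤ.* x₂ → ∣ x₁ ∣ ∣ ∣ x₂ ∣ * ∣ x₂ ∣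
x₁x₃≡x₂²⇒∣x₁∣∣∣x₂∣² {x₁} {x₂} {x₃} x₁x₃≡x₂² = divides ∣ x₃ ∣ (begin
  ∣ x₂ ∣ * ∣ x₂ ∣  ≡⟨ sym (ℤₚ.abs-* x₂ x₂) ⟩
  ∣ x₂ ℤ.* x₂ ∣    ≡⟨ cong ∣_∣ (sym x₁x₃≡x₂²) ⟩
  ∣ x₁ ℤ.* x₃ ∣    ≡⟨ ℤₚ.abs-* x₁ x₃ ⟩
  ∣ x₁ ∣ * ∣ x₃ ∣  ≡⟨ *-comm ∣ x₁ ∣ ∣ x₃ ∣ ⟩
  ∣ x₃ ∣ * ∣ x₁ ∣  ∎)
  where open ≡-Reasoning

degenerate-pair : ∀ {q u H₁ H₂ x₁ x₂ x₃} → Prime q → ¬ q ∣ ∣ x₁ ∣ → ∣ x₁ ∣ ≤ H₁ → ∣ x₂ ∣ ≤ H₂ →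
                  x₁ ℤ.* x₃ ≡ x₂ ℤ.* x₂ → + u ℤ.* x₁ ≡ x₂ mod q →
                  ∃[ w ] (w ∈ pairs H₁ H₂ × Ratio q (proj₁ w) (proj₂ w) u)
degenerate-pair {q} {x₁ = + zero} _ q∤x₁ _ _ _ _ = ⊥-elim (q∤x₁ (q ∣0))
degenerate-pair {q} {u} {H₁} {H₂} {+ suc n} {x₂} {x₃} pq q∤x₁ x₁≤H₁ x₂≤H₂ x₁x₃≡x₂² ux₁≡x₂ =
  positive-degenerate-pair {u = u} {H₂ = H₂} {y = x₂} pq q∤x₁ (s≤s z≤n) x₁≤H₁ x₂≤H₂
    (x₁x₃≡x₂²⇒∣x₁∣∣∣x₂∣² {+ suc n} {x₂} {x₃} x₁x₃≡x₂²) ux₁≡x₂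
degenerate-pair {q} {u} {H₁} {H₂} { -[1+ n ]} {x₂} {x₃} pq q∤x₁ x₁≤H₁ x₂≤H₂ x₁x₃≡x₂² ux₁≡x₂ =
  positive-degenerate-pair {u = u} {H₂ = H₂} {y = ℤ.- x₂} pq q∤x₁ (s≤s z≤n) x₁≤H₁ (≤-trans (≤-reflexive ∣-x₂∣≡∣x₂∣) x₂≤H₂)
    (subst (λ z → suc n ∣ z * z) (sym ∣-x₂∣≡∣x₂∣) (x₁x₃≡x₂²⇒∣x₁∣∣∣x₂∣² { -[1+ n ]} {x₂} {x₃} x₁x₃≡x₂²))
    (subst (λ z → z ≡ ℤ.- x₂ mod q) (ℤₚ.neg-distribʳ-* (+ u) -[1+ n ]) (-‿cong-mod ux₁≡x₂))
  where
  ∣-x₂∣≡∣x₂∣ : ∣ ℤ.- x₂ ∣ ≡ ∣ x₂ ∣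
  ∣-x₂∣≡∣x₂∣ = ℤₚ.∣-i∣≡∣i∣ x₂

-- Witnesses for the elements of 𝒰_{n,q}(h)

pair-weight : ℕ → ℕ → ℤ × ℤ → ℕ
pair-weight q u w = 𝟙 (ratio? q (proj₁ w) (proj₂ w) u)

triple-weight : ℕ → ℕ → ℤ × ℤ × ℤ → ℕ
triple-weight q u t = 𝟙 (ratio? q (proj₁ (proj₂ t)) (proj₁ t) u) * 𝟙 (q ∣? ∣ norm t ∣)

witness-count : ℕ → ℕ → ℕ → ℕ → ℕ → ℕ
witness-count q H₁ H₂ H₃ u =
  𝟙 (u ≟ 0) + (∑ (pairs H₁ H₂) (pair-weight q u) + ∑ (nondegenerate-triples H₁ H₂ H₃) (triple-weight q u))

module _ {q u H₁ H₂ H₃ : ℕ} where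

  pair⇒witnessed : ∀ {w} → w ∈ pairs H₁ H₂ → Ratio q (proj₁ w) (proj₂ w) u → 1 ≤ witness-count q H₁ H₂ H₃ u
  pair⇒witnessed {w} w∈ ratio = begin
    1                                                    ≡⟨ sym (𝟙-yes (ratio? q (proj₁ w) (proj₂ w) u) ratio) ⟩
    pair-weight q u w                                    ≤⟨ ≤-∑ (pair-weight q u) w∈ ⟩
    ∑ (pairs H₁ H₂) (pair-weight q u)                    ≤⟨ m≤m+n _ _ ⟩
    ∑ (pairs H₁ H₂) (pair-weight q u) + ∑ (nondegenerate-triples H₁ H₂ H₃) (triple-weight q u)
                                                         ≤⟨ m≤n+m _ (𝟙 (u ≟ 0)) ⟩
    witness-count q H₁ H₂ H₃ u                           ∎
    where open ≤-Reasoning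

  triple⇒witnessed : ∀ {t} → t ∈ nondegenerate-triples H₁ H₂ H₃ → triple-weight q u t ≡ 1 → 1 ≤ witness-count q H₁ H₂ H₃ u
  triple⇒witnessed {t} t∈ weight≡1 = begin
    1                                                    ≡⟨ sym weight≡1 ⟩
    triple-weight q u t                                  ≤⟨ ≤-∑ (triple-weight q u) t∈ ⟩
    ∑ (nondegenerate-triples H₁ H₂ H₃) (triple-weight q u) ≤⟨ m≤n+m _ _ ⟩
    ∑ (pairs H₁ H₂) (pair-weight q u) + ∑ (nondegenerate-triples H₁ H₂ H₃) (triple-weight q u)
                                                         ≤⟨ m≤n+m _ (𝟙 (u ≟ 0)) ⟩
    witness-count q H₁ H₂ H₃ u                           ∎
    where open ≤-Reasoning

witnessed : ∀ {q u H₁ H₂ H₃ x₁ x₂ x₃} → Prime q → ∣ x₁ ∣ ≤ H₁ → ∣ x₂ ∣ ≤ H₂ → ∣ x₃ ∣ ≤ H₃ →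
            Ratio q x₂ x₁ u → x₁ ℤ.* x₃ ≡ x₂ ℤ.* x₂ mod q → 1 ≤ witness-count q H₁ H₂ H₃ u
witnessed {q} {u} {H₁} {H₂} {H₃} {x₁} {x₂} {x₃} pq b₁ b₂ b₃ ratio x₁x₃≡x₂² with norm (x₁ , x₂ , x₃) ℤ.≟ ℤ.0ℤ
... | no  N≢0 = triple⇒witnessed {q} {u} {H₁} {H₂} {H₃} (∈-filter⁺ nondegenerate? (∈-triples⁺ x₁ x₂ x₃ b₁ b₂ b₃) N≢0)
                  (cong₂ _*_ (𝟙-yes (ratio? q x₂ x₁ u) ratio) (𝟙-yes (q ∣? _) (ℤ∣.∣⇒∣ᵤ (q∣x-y x₁x₃≡x₂²))))
... | yes N≡0 with degenerate-pair {u = u} {H₂ = H₂} {x₃ = x₃} pq (proj₁ ratio) b₁ b₂ (ℤₚ.i-j≡0⇒i≡j _ _ N≡0) (proj₂ ratio)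
...   | _ , w∈ , w-ratio = pair⇒witnessed {q} {u} {H₁} {H₂} {H₃} w∈ w-ratio

bohr⇒witnessed : ∀ {q u s H₁ H₂ H₃ x₁ x₂ x₃} → Prime q → u < q → 0 < s → s < q →
                 ∣ x₁ ∣ ≤ H₁ → ∣ x₂ ∣ ≤ H₂ → ∣ x₃ ∣ ≤ H₃ →
                 + (s * u ^ 1) ≡ x₁ mod q → + (s * u ^ 2) ≡ x₂ mod q → + (s * u ^ 3) ≡ x₃ mod q →
                 1 ≤ witness-count q H₁ H₂ H₃ u
bohr⇒witnessed {u = zero} _ _ _ _ _ _ _ _ _ _ = s≤s z≤n
bohr⇒witnessed {q} {u@(suc _)} {s} {x₁ = x₁} pq u<q 0<s s<q b₁ b₂ b₃ e₁ e₂ e₃ =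
  witnessed {u = u} pq b₁ b₂ b₃ (q∤x₁ , progression-ratio (+ s) (+ u) (as-progression 1 e₁) (as-progression 2 e₂))
    (progression-square (+ s) (+ u) (as-progression 1 e₁) (as-progression 2 e₂) (as-progression 3 e₃))
  where
  as-progression : ∀ k {x} → + (s * u ^ k) ≡ x mod q → + s ℤ.* (+ u) ℤ.^ k ≡ x mod q
  as-progression k {x} = subst (λ z → z ≡ x mod q) (trans (ℤₚ.pos-* s (u ^ k)) (cong (ℤ._*_ (+ s)) (pos-^ u k)))
  q∤x₁ : ¬ q ∣ ∣ x₁ ∣
  q∤x₁ q∣x₁ = prime∤* pq 0<s s<q (s≤s z≤n) u<q (subst (λ z → q ∣ s * z) (*-identityʳ u) (∣-resp-≡-mod e₁ q∣x₁))

bohr-element : ∀ {p n h u} → T (inUᵇ p n h u) → ∃[ s ] (s < p × ∀ j → distq p (suc s * u ^ suc (toℕ j)) ≤ h j)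
bohr-element {p} {n} {h} {u} inU with find (any⁻ _ (upTo p) inU)
... | s , s∈ , inBohr = s , ∈-upTo⁻ s∈ , λ j → ≤ᵇ⇒≤ _ _ (All.lookup (all⁺ _ (allFin n) inBohr) (∈-allFin j))

inU⇒witnessed : ∀ {p m u} (h : Fin (3 + m) → ℕ) → Prime (suc p) → u < suc p → T (inUᵇ p (3 + m) h u) →
                1 ≤ witness-count (suc p) (h zero) (h (suc zero)) (h (suc (suc zero))) u
inU⇒witnessed {p} {m} {u} h pq u<q inU with bohr-element {h = h} {u = u} inU
... | s , s<p , dist
  with nearest-residue p (suc s * u ^ 1) (dist zero)
     | nearest-residue p (suc s * u ^ 2) (dist (suc zero))
     | nearest-residue p (suc s * u ^ 3) (dist (suc (suc zero)))
...   | x₁ , b₁ , e₁ | x₂ , b₂ , e₂ | x₃ , b₃ , e₃ = bohr⇒witnessed pq u<q (s≤s z≤n) (s≤s s<p) b₁ b₂ b₃ e₁ e₂ e₃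

∑-witness-count≤ : ∀ {q} H₁ H₂ H₃ → Prime q →
                   ∑ (upTo q) (witness-count q H₁ H₂ H₃)
                   ≤ 1 + (length (pairs H₁ H₂) + ∑ (nondegenerate-triples H₁ H₂ H₃) (λ t → 𝟙 (q ∣? ∣ norm t ∣)))
∑-witness-count≤ {q} H₁ H₂ H₃ pq = begin
  ∑ us (witness-count q H₁ H₂ H₃)
    ≡⟨ trans (∑-+ us _ _) (cong (_+_ (∑ us (λ u → 𝟙 (u ≟ 0)))) (∑-+ us _ _)) ⟩
  ∑ us (λ u → 𝟙 (u ≟ 0)) + (∑ us (λ u → ∑ P (pair-weight q u)) + ∑ us (λ u → ∑ N (triple-weight q u)))
    ≡⟨ cong (_+_ (∑ us (λ u → 𝟙 (u ≟ 0)))) (cong₂ _+_ (∑-swap us P _) (∑-swap us N _)) ⟩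
  ∑ us (λ u → 𝟙 (u ≟ 0)) + (∑ P (λ w → ∑ us (λ u → pair-weight q u w)) + ∑ N (λ t → ∑ us (λ u → triple-weight q u t)))
    ≤⟨ +-mono-≤ (∑𝟙≤1 (_≟ 0) (upTo⁺ q) (λ _ _ x≡0 y≡0 → trans x≡0 (sym y≡0))) (+-mono-≤ pairs≤ triples≤) ⟩
  1 + (length P + ∑ N (λ t → 𝟙 (q ∣? ∣ norm t ∣)))
    ∎
  where
  open ≤-Reasoning
  us = upTo q
  P = pairs H₁ H₂
  N = nondegenerate-triples H₁ H₂ H₃
  pairs≤ : ∑ P (λ w → ∑ us (λ u → pair-weight q u w)) ≤ length P
  pairs≤ = ≤-trans (∑≤length* P (λ {w} _ → ∑-ratio≤1 (proj₁ w) (proj₂ w) pq)) (≤-reflexive (*-identityʳ (length P)))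
  triples≤ : ∑ N (λ t → ∑ us (λ u → triple-weight q u t)) ≤ ∑ N (λ t → 𝟙 (q ∣? ∣ norm t ∣))
  triples≤ = ∑-mono-≤ N (λ {t} _ → begin
    ∑ us (λ u → triple-weight q u t)                                       ≡⟨ ∑-*ʳ us _ (𝟙 (q ∣? ∣ norm t ∣)) ⟩
    ∑ us (𝟙 ∘ ratio? q (proj₁ (proj₂ t)) (proj₁ t)) * 𝟙 (q ∣? ∣ norm t ∣)  ≤⟨ *-monoˡ-≤ _ (∑-ratio≤1 _ _ pq) ⟩
    1 * 𝟙 (q ∣? ∣ norm t ∣)                                                ≡⟨ *-identityˡ _ ⟩
    𝟙 (q ∣? ∣ norm t ∣)                                                    ∎)

#U≤ : ∀ {m q} (h : Fin (3 + m) → ℕ) → Prime q →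
      #U (3 + m) q h ≤ 1 + (length (pairs (h zero) (h (suc zero)))
                            + ∑ (nondegenerate-triples (h zero) (h (suc zero)) (h (suc (suc zero)))) (λ t → 𝟙 (q ∣? ∣ norm t ∣)))
#U≤ {q = zero}      h pq = z≤n
#U≤ {m} {q@(suc p)} h pq = begin
  #U (3 + m) q h                                  ≡⟨ length-filter≡∑𝟙 (T? ∘ inUᵇ p (3 + m) h) (upTo q) ⟩
  ∑ (upTo q) (λ u → 𝟙 (T? (inUᵇ p (3 + m) h u)))  ≤⟨ ∑-mono-≤ (upTo q) (λ u∈ → 𝟙≤witness-count (∈-upTo⁻ u∈)) ⟩
  ∑ (upTo q) (witness-count q H₁ H₂ H₃)           ≤⟨ ∑-witness-count≤ H₁ H₂ H₃ pq ⟩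
  _                                               ∎
  where
  open ≤-Reasoning
  H₁ = h zero
  H₂ = h (suc zero)
  H₃ = h (suc (suc zero))
  𝟙≤witness-count : ∀ {u} → u < q → 𝟙 (T? (inUᵇ p (3 + m) h u)) ≤ witness-count q H₁ H₂ H₃ u
  𝟙≤witness-count {u} u<q with T? (inUᵇ p (3 + m) h u)
  ... | yes inU = inU⇒witnessed h pq u<q inU
  ... | no  _   = z≤n

-- Averaging over the primes

∑-over-primes : ∀ {Q H₁ H₂ H₃} (f : ℕ → ℕ) → Unique Q → All Prime Q → 1 ≤ H₁ → H₁ ≤ H₂ → H₂ ≤ H₃ →
                (∀ {q} → Prime q → f q ≤ 1 + (length (pairs H₁ H₂) + ∑ (nondegenerate-triples H₁ H₂ H₃) (λ t → 𝟙 (q ∣? ∣ norm t ∣)))) →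
                ∑ Q f * LL H₃ ≤ length Q * (6 * (H₂ * L H₂)) * LL H₃ + 3 * H₁ * (3 * H₂ * (3 * H₃)) * (14 * L H₃)
∑-over-primes {Q} {H₁} {H₂} {H₃} f unique primes 1≤H₁ H₁≤H₂ H₂≤H₃ f≤ = begin
  ∑ Q f * LL H₃
    ≤⟨ *-monoˡ-≤ (LL H₃) (∑-mono-≤ Q (λ {q} q∈ → ≤-trans (f≤ (All.lookup primes q∈)) (≤-reflexive (sym (+-assoc 1 (length P) (D q)))))) ⟩
  ∑ Q (λ q → 1 + length P + D q) * LL H₃
    ≡⟨ trans (cong (_* LL H₃) (∑-+ Q (λ _ → 1 + length P) D)) (*-distribʳ-+ (LL H₃) (∑ Q (λ _ → 1 + length P)) (∑ Q D)) ⟩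
  ∑ Q (λ _ → 1 + length P) * LL H₃ + ∑ Q D * LL H₃
    ≤⟨ +-mono-≤ (*-monoˡ-≤ (LL H₃) (∑≤length* Q (λ _ → 1+length-pairs≤ 1≤H₁ H₁≤H₂))) divisors≤ ⟩
  length Q * (6 * (H₂ * L H₂)) * LL H₃ + 3 * H₁ * (3 * H₂ * (3 * H₃)) * (14 * L H₃)
    ∎
  where
  open ≤-Reasoning
  P = pairs H₁ H₂
  N = nondegenerate-triples H₁ H₂ H₃
  D : ℕ → ℕ
  D q = ∑ N (λ t → 𝟙 (q ∣? ∣ norm t ∣))
  1≤H₂ : 1 ≤ H₂
  1≤H₂ = ≤-trans 1≤H₁ H₁≤H₂
  divisors≤ : ∑ Q D * LL H₃ ≤ 3 * H₁ * (3 * H₂ * (3 * H₃)) * (14 * L H₃)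
  divisors≤ = begin
    ∑ Q D * LL H₃                                        ≡⟨ cong (_* LL H₃) (∑-swap Q N _) ⟩
    ∑ N (λ t → ∑ Q (λ q → 𝟙 (q ∣? ∣ norm t ∣))) * LL H₃  ≡⟨ sym (∑-*ʳ N _ (LL H₃)) ⟩
    ∑ N (λ t → ∑ Q (λ q → 𝟙 (q ∣? ∣ norm t ∣)) * LL H₃)  ≤⟨ ∑≤length* N (prime-divisors-of-norm unique primes (≤-trans H₁≤H₂ H₂≤H₃) H₂≤H₃) ⟩
    length N * (14 * L H₃)
      ≤⟨ *-monoˡ-≤ (14 * L H₃) (≤-trans (List.length-filter nondegenerate? (triples H₁ H₂ H₃)) (length-triples≤ 1≤H₁ 1≤H₂ (≤-trans 1≤H₂ H₂≤H₃))) ⟩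
    3 * H₁ * (3 * H₂ * (3 * H₃)) * (14 * L H₃)           ∎

final-arithmetic : ∀ n H₁ H₂ H₃ ℓ₂ ℓ₃ λ₃ → 1 ≤ ℓ₂ →
                   n * (6 * (H₂ * ℓ₂)) * λ₃ + 3 * H₁ * (3 * H₂ * (3 * H₃)) * (14 * ℓ₃)
                   ≤ 378 * (n * H₂ * ℓ₂ ^ 2 * λ₃ + H₁ * H₂ * H₃ * ℓ₃)
final-arithmetic n H₁ H₂ H₃ ℓ₂ ℓ₃ λ₃ 1≤ℓ₂ = begin
  n * (6 * (H₂ * ℓ₂)) * λ₃ + 3 * H₁ * (3 * H₂ * (3 * H₃)) * (14 * ℓ₃)
    ≡⟨ identity n H₁ H₂ H₃ ℓ₂ ℓ₃ λ₃ ⟩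
  6 * (n * H₂ * ℓ₂ * λ₃) + 378 * (H₁ * H₂ * H₃ * ℓ₃)
    ≤⟨ +-monoˡ-≤ (378 * (H₁ * H₂ * H₃ * ℓ₃)) (*-mono-≤ (m≤m+n 6 372) (*-monoˡ-≤ λ₃ (*-monoʳ-≤ (n * H₂) ℓ≤ℓ²))) ⟩
  378 * (n * H₂ * ℓ₂ ^ 2 * λ₃) + 378 * (H₁ * H₂ * H₃ * ℓ₃)
    ≡⟨ sym (*-distribˡ-+ 378 (n * H₂ * ℓ₂ ^ 2 * λ₃) (H₁ * H₂ * H₃ * ℓ₃)) ⟩
  378 * (n * H₂ * ℓ₂ ^ 2 * λ₃ + H₁ * H₂ * H₃ * ℓ₃)
    ∎
  where
  open ≤-Reasoning
  identity : ∀ n H₁ H₂ H₃ ℓ₂ ℓ₃ λ₃ → n * (6 * (H₂ * ℓ₂)) * λ₃ + 3 * H₁ * (3 * H₂ * (3 * H₃)) * (14 * ℓ₃)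
                                     ≡ 6 * (n * H₂ * ℓ₂ * λ₃) + 378 * (H₁ * H₂ * H₃ * ℓ₃)
  identity = ℕ-Solver.solve-∀
  ℓ≤ℓ² : ℓ₂ ≤ ℓ₂ ^ 2
  ℓ≤ℓ² = ≤-trans (≤-reflexive (sym (*-identityʳ ℓ₂))) (*-monoʳ-≤ ℓ₂ (≤-trans 1≤ℓ₂ (≤-reflexive (sym (*-identityʳ ℓ₂)))))

theorem2p4 : (m : ℕ) → ∃[ C ] ((h : Fin (3 + m) → ℕ) →
    1 Data.Nat.≤ h zero →
    (∀ i j → i Data.Fin.≤ j → h i Data.Nat.≤ h j) →
    (Q : List ℕ) → Unique Q → All Prime Q → 1 Data.Nat.≤ length Q →
    sum (map (λ q → #U (3 + m) q h) Q) * LL (h (suc (suc zero)))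
      Data.Nat.≤ C * (length Q * h (suc zero) * L (h (suc zero)) ^ 2 * LL (h (suc (suc zero)))
                      + h zero * h (suc zero) * h (suc (suc zero)) * L (h (suc (suc zero)))))
theorem2p4 m = 378 , λ h 1≤H₁ monotone Q unique primes _ →
  let H₁ = h zero
      H₂ = h (suc zero)
      H₃ = h (suc (suc zero))
  in begin
    sum (map (λ q → #U (3 + m) q h) Q) * LL H₃
      ≡⟨ cong (_* LL H₃) (sum-map (λ q → #U (3 + m) q h) Q) ⟩
    ∑ Q (λ q → #U (3 + m) q h) * LL H₃
      ≤⟨ ∑-over-primes _ unique primes 1≤H₁ (monotone zero (suc zero) z≤n) (monotone (suc zero) (suc (suc zero)) (s≤s z≤n)) (#U≤ h) ⟩
    length Q * (6 * (H₂ * L H₂)) * LL H₃ + 3 * H₁ * (3 * H₂ * (3 * H₃)) * (14 * L H₃)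
      ≤⟨ final-arithmetic (length Q) H₁ H₂ H₃ (L H₂) (L H₃) (LL H₃) (m≤m⊔n 1 ⌊log₂ H₂ ⌋) ⟩
    378 * (length Q * H₂ * L H₂ ^ 2 * LL H₃ + H₁ * H₂ * H₃ * L H₃)
      ∎
  where open ≤-Reasoning
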